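{- Let $r \ge k \ge 2$ and $q > 0$ be integers. There are unique integers $a$, $b$ and $m$ such that $q = \binom{a}{k}_r + \binom{b}{k-1}_{r-1} + m$, $a - \lfloor a/r \rfloor > b$, and $\binom{b - \lfloor b/(r-1) \rfloor}{k-2}_{r-2} > m \ge 0$.
   Context: The Turán graph $T_{n,r}$ is obtained by partitioning $n$ vertices into $r$ parts as evenly as possible and joining two vertices exactly when they lie in different parts. $\binom{n}{k}_r$ denotes the number of cliques on $k$ vertices in $T_{n,r}$ (it is $0$ when $k > r$ or $k > n$, and $\binom{n}{0}_r = 1$). -}

module Defs where

open import Data.Nat using (ℕ; zero; suc; _+_; _∸_; _≡ᵇ_; _<_; _≤_)
open import Data.Nat.DivMod using (_/_; _%_)
open import Data.Bool using (Bool; true; false; _∧_; _∨_; not; if_then_else_)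
open import Data.Fin using (Fin; toℕ)
open import Data.Fin.Subset using (Subset; ∣_∣)
open import Data.Vec using (Vec; []; _∷_; lookup)
open import Data.List using (List; []; _∷_; _++_; map; length; filter; allFin; cartesianProduct)
open import Data.Bool.ListAction using (and)
open import Data.Product using (_×_; _,_; Σ; proj₁; proj₂)
open import Relation.Binary.PropositionalEquality using (_≡_)
open import Relation.Nullary.Decidable using (T?)
open import Data.Bool using (T)

-- floor division, with the (unused) convention  a div 0 = 0
_div_ : ℕ → ℕ → ℕ
a div zero    = zero
a div (suc r) = a / suc r

-- The parts have sizes differing by at most one,
-- i.e. the partition is as even as possible.  (For r = 0 no such
-- partition exists for n > 0; we use the placeholder v itself.)
part : (r : ℕ) {n : ℕ} → Fin n → ℕ
part zero    v = toℕ v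
part (suc r) v = toℕ v % suc r

turánAdj : (r : ℕ) {n : ℕ} → Fin n → Fin n → Bool
turánAdj r u v = not (part r u ≡ᵇ part r v)

allSubsets : (n : ℕ) → List (Subset n)
allSubsets zero    = [] ∷ []
allSubsets (suc n) = map (true ∷_) (allSubsets n) ++ map (false ∷_) (allSubsets n)

isCliqueᵇ : {n : ℕ} → (Fin n → Fin n → Bool) → Subset n → Bool
isCliqueᵇ {n} adj S =
  and (map (λ p → not (lookup S (proj₁ p) ∧ lookup S (proj₂ p))
             ∨ (toℕ (proj₁ p) ≡ᵇ toℕ (proj₂ p))
             ∨ adj (proj₁ p) (proj₂ p))
      (cartesianProduct (allFin n) (allFin n)))

numCliques : (n : ℕ) → (Fin n → Fin n → Bool) → ℕ → ℕ
numCliques n adj k =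
  length (filter (λ S → T? ((∣ S ∣ ≡ᵇ k) ∧ isCliqueᵇ adj S)) (allSubsets n))

binomT : (n k r : ℕ) → ℕ
binomT n k r = numCliques n (turánAdj r) k

Repr : (r k q a b m : ℕ) → Set
Repr r k q a b m =
  (q ≡ binomT a k r + binomT b (k ∸ 1) (r ∸ 1) + m)
  × (b < a ∸ (a div r))
  × (m < binomT (b ∸ (b div (r ∸ 1))) (k ∸ 2) (r ∸ 2))

module Submission where

-- The heart of the proof is Pascal's rule for Turán clique numbers (turán-pascal):
--   binom(n+1, j+1)_{s+1} = binom(n, j+1)_{s+1} + binom(n - ⌊n/(s+1)⌋, j)_s,
-- because the cliques through the new vertex are those of the Turán graph left after
-- deleting its class, which is a smallest class.  To prove it, cliques of a complete
-- multipartite graph are identified with rainbow vertex sets (distinct class labels),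
-- whose number is the elementary symmetric polynomial e_k of the class sizes
-- (rainbowCount-e); Pascal's rule is then an identity between such polynomials.
-- Given the rule, binom(a,k)_r grows by steps binom(a - ⌊a/r⌋, k-1)_{r-1}, which grow
-- by steps binom(b - ⌊b/(r-1)⌋, k-2)_{r-2}.  The theorem is two nested levels of greedy
-- digit extraction (Increments, TwoLevel), valid for any such nondecreasing unbounded f.

open import Defs
open import Data.Nat using (ℕ; zero; suc; _+_; _*_; _∸_; _≡ᵇ_; _<ᵇ_; _≤_; _<_; z≤n; s≤s; z<s)
open import Data.Nat.Properties
open import Data.Bool using (Bool; true; false; _∧_; _∨_; not; if_then_else_; T)
open import Data.Bool.Properties using (T-∧; T-∨; ∧-zeroʳ)
open import Data.Nat.DivMod using (_/_; _%_; m≡m%n+[m/n]*n; [m+kn]%n≡m%n; m<n⇒m%n≡m; +-distrib-/; m*n%n≡0; m<n⇒m/n≡0; m*n/n≡m; m%n<n; n/1≡n)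
open import Data.Fin using (Fin; zero; suc; toℕ; inject₁; fromℕ) renaming (_≟_ to _≟ᶠ_)
open import Data.Fin.Properties using (toℕ-injective; toℕ-inject₁; toℕ-fromℕ) renaming (suc-injective to Fin-suc-injective)
open import Data.Fin.Subset using (Subset; ∣_∣)
open import Data.Vec using ([]; _∷_; lookup)
open import Data.List using (List; []; _∷_; _++_; map; length; filter; allFin; cartesianProduct)
import Data.List.Relation.Unary.All as All
open import Data.List.Relation.Unary.All.Properties using (all⁺; all⁻)
open import Data.List.Membership.Propositional.Properties using (∈-cartesianProduct⁺; ∈-allFin)
open import Data.Product using (Σ; _×_; _,_; proj₁; proj₂)
open import Data.Sum using (_⊎_; inj₁; inj₂; map₁)
open import Data.Empty using (⊥; ⊥-elim)
open import Function using (_∘_; Equivalence)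
open import Relation.Binary.PropositionalEquality
open import Relation.Binary.Definitions using (tri<; tri≈; tri>)
open import Relation.Nullary using (¬_; yes; no)
open import Relation.Nullary.Decidable using (T?; dec-true; dec-false)
open import Data.Nat.Solver using (module +-*-Solver)
open +-*-Solver using (solve; _:+_; _:*_; _:=_; con)

𝟙 : Bool → ℕ
𝟙 true  = 1
𝟙 false = 0

count : {A : Set} → (A → Bool) → List A → ℕ
count p []       = 0
count p (x ∷ xs) = 𝟙 (p x) + count p xs

length-filter : {A : Set} (p : A → Bool) (xs : List A) →
  length (filter (T? ∘ p) xs) ≡ count p xs
length-filter p [] = refl
length-filter p (x ∷ xs) with p x
... | true  = cong suc (length-filter p xs)
... | false = length-filter p xs

count-++ : {A : Set} (p : A → Bool) (xs ys : List A) →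
  count p (xs ++ ys) ≡ count p xs + count p ys
count-++ p []       ys = refl
count-++ p (x ∷ xs) ys =
  trans (cong (𝟙 (p x) +_) (count-++ p xs ys)) (sym (+-assoc (𝟙 (p x)) _ _))

count-map : {A B : Set} (p : B → Bool) (f : A → B) (xs : List A) →
  count p (map f xs) ≡ count (p ∘ f) xs
count-map p f []       = refl
count-map p f (x ∷ xs) = cong (𝟙 (p (f x)) +_) (count-map p f xs)

count-cong : {A : Set} {p q : A → Bool} → (∀ x → p x ≡ q x) →
  (xs : List A) → count p xs ≡ count q xs
count-cong p≗q []       = refl
count-cong p≗q (x ∷ xs) = cong₂ _+_ (cong 𝟙 (p≗q x)) (count-cong p≗q xs)

count-false : {A : Set} {p : A → Bool} → (∀ x → p x ≡ false) → (xs : List A) → count p xs ≡ 0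
count-false p≗false []       = refl
count-false p≗false (x ∷ xs) = cong₂ _+_ (cong 𝟙 (p≗false x)) (count-false p≗false xs)

T-ext : {a b : Bool} → (T a → T b) → (T b → T a) → a ≡ b
T-ext {false} {false} _ _  = refl
T-ext {false} {true}  _ ba = ⊥-elim (ba _)
T-ext {true}  {false} ab _ = ⊥-elim (ab _)
T-ext {true}  {true}  _ _  = refl

not-T : {b : Bool} → T (not b) → ¬ T b
not-T {true} () _

T-not : {b : Bool} → ¬ T b → T (not b)
T-not {false} _  = _
T-not {true}  ¬b = ¬b _

-- The complete multipartite graph on Fin n whose classes are the fibres of the
-- labelling p.  The Turán graph is the case p = part r: turánAdj r = multipartiteAdj (part r).
multipartiteAdj : {n : ℕ} → (Fin n → ℕ) → Fin n → Fin n → Bool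
multipartiteAdj p u v = not (p u ≡ᵇ p v)

Separated : {n : ℕ} → (Fin n → ℕ) → Subset n → Fin n → Fin n → Set
Separated p S u v = T (lookup S u) → T (lookup S v) → u ≢ v → p u ≢ p v

-- The vertices chosen by S carry pairwise distinct labels, none of them forbidden by F.
-- For F everywhere false these are exactly the cliques of multipartiteAdj p.
record Rainbow {n : ℕ} (p : Fin n → ℕ) (F : ℕ → Bool) (S : Subset n) : Set where
  constructor _,_
  field
    separated : ∀ u v → Separated p S u v
    allowed   : ∀ u → T (lookup S u) → ¬ T (F (p u))

forbid : ℕ → (ℕ → Bool) → ℕ → Bool
forbid c F i = (c ≡ᵇ i) ∨ F i

forbid-new : {c i : ℕ} (F : ℕ → Bool) → c ≡ i → T (forbid c F i)
forbid-new {c} {i} _ eq = Equivalence.from (T-∨ {c ≡ᵇ i}) (inj₁ (≡⇒≡ᵇ c i eq))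

forbid-old : (c : ℕ) {i : ℕ} (F : ℕ → Bool) → T (F i) → T (forbid c F i)
forbid-old c {i} _ Fi = Equivalence.from (T-∨ {c ≡ᵇ i}) (inj₂ Fi)

forbid-cases : {c i : ℕ} (F : ℕ → Bool) → T (forbid c F i) → c ≡ i ⊎ T (F i)
forbid-cases {c} {i} _ t = map₁ (≡ᵇ⇒≡ c i) (Equivalence.to (T-∨ {c ≡ᵇ i}) t)

rainbowᵇ : {n : ℕ} → (Fin n → ℕ) → (ℕ → Bool) → Subset n → Bool
rainbowᵇ p F []          = true
rainbowᵇ p F (false ∷ S) = rainbowᵇ (p ∘ suc) F S
rainbowᵇ p F (true ∷ S)  = not (F (p zero)) ∧ rainbowᵇ (p ∘ suc) (forbid (p zero) F) S

module _ {n : ℕ} {p : Fin (suc n) → ℕ} {F : ℕ → Bool} {S : Subset n} where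

  rainbow-skip⁺ : Rainbow (p ∘ suc) F S → Rainbow p F (false ∷ S)
  rainbow-skip⁺ (separated , allowed) = separated′ , allowed′
    where
    separated′ : ∀ u v → Separated p (false ∷ S) u v
    separated′ zero    _       ()
    separated′ (suc u) zero    _  ()
    separated′ (suc u) (suc v) su sv u≢v = separated u v su sv (u≢v ∘ cong suc)
    allowed′ : ∀ u → T (lookup (false ∷ S) u) → ¬ T (F (p u))
    allowed′ zero    ()
    allowed′ (suc u) = allowed u

  rainbow-skip⁻ : Rainbow p F (false ∷ S) → Rainbow (p ∘ suc) F S
  rainbow-skip⁻ (separated , allowed) =
    (λ u v su sv u≢v → separated (suc u) (suc v) su sv (u≢v ∘ Fin-suc-injective)) ,
    (λ u → allowed (suc u))

  rainbow-take⁺ : ¬ T (F (p zero)) → Rainbow (p ∘ suc) (forbid (p zero) F) S →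
                  Rainbow p F (true ∷ S)
  rainbow-take⁺ first (separated , allowed) = separated′ , allowed′
    where
    separated′ : ∀ u v → Separated p (true ∷ S) u v
    separated′ zero    zero    _  _  u≢v _  = u≢v refl
    separated′ zero    (suc v) _  sv _   eq = allowed v sv (forbid-new F eq)
    separated′ (suc u) zero    su _  _   eq = allowed u su (forbid-new F (sym eq))
    separated′ (suc u) (suc v) su sv u≢v = separated u v su sv (u≢v ∘ cong suc)
    allowed′ : ∀ u → T (lookup (true ∷ S) u) → ¬ T (F (p u))
    allowed′ zero    _  = first
    allowed′ (suc u) su = allowed u su ∘ forbid-old (p zero) F

  rainbow-take⁻ : Rainbow p F (true ∷ S) →
                  ¬ T (F (p zero)) × Rainbow (p ∘ suc) (forbid (p zero) F) S
  rainbow-take⁻ (separated , allowed) =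
    allowed zero _ ,
    (λ u v su sv u≢v → separated (suc u) (suc v) su sv (u≢v ∘ Fin-suc-injective)) ,
    allowed′
    where
    allowed′ : ∀ u → T (lookup S u) → ¬ T (forbid (p zero) F (p (suc u)))
    allowed′ u su t with forbid-cases F t
    ... | inj₁ same = separated (suc u) zero su _ (λ ()) (sym same)
    ... | inj₂ bad  = allowed (suc u) su bad

rainbowᵇ-sound : {n : ℕ} {p : Fin n → ℕ} {F : ℕ → Bool} (S : Subset n) →
                 T (rainbowᵇ p F S) → Rainbow p F S
rainbowᵇ-sound []          _ = (λ ()) , (λ ())
rainbowᵇ-sound (false ∷ S) h = rainbow-skip⁺ (rainbowᵇ-sound S h)
rainbowᵇ-sound {p = p} {F} (true ∷ S) h =
  let first , rest = Equivalence.to (T-∧ {not (F (p zero))}) h in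
  rainbow-take⁺ (not-T first) (rainbowᵇ-sound S rest)

rainbowᵇ-complete : {n : ℕ} {p : Fin n → ℕ} {F : ℕ → Bool} (S : Subset n) →
                    Rainbow p F S → T (rainbowᵇ p F S)
rainbowᵇ-complete []          _ = _
rainbowᵇ-complete (false ∷ S) r = rainbowᵇ-complete S (rainbow-skip⁻ r)
rainbowᵇ-complete {p = p} {F} (true ∷ S) r =
  let first , rest = rainbow-take⁻ r in
  Equivalence.from (T-∧ {not (F (p zero))}) (T-not first , rainbowᵇ-complete S rest)

cliquePairᵇ : {n : ℕ} → (Fin n → Fin n → Bool) → Subset n → Fin n × Fin n → Bool
cliquePairᵇ adj S (u , v) = not (lookup S u ∧ lookup S v) ∨ (toℕ u ≡ᵇ toℕ v) ∨ adj u v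

module _ {n : ℕ} (p : Fin n → ℕ) (S : Subset n) where

  cliquePair-sound : ∀ u v → T (cliquePairᵇ (multipartiteAdj p) S (u , v)) → Separated p S u v
  cliquePair-sound u v t su sv u≢v pu≡pv
    with Equivalence.to (T-∨ {not (lookup S u ∧ lookup S v)}) t
  ... | inj₁ notBoth = not-T notBoth (Equivalence.from (T-∧ {lookup S u}) (su , sv))
  ... | inj₂ t′ with Equivalence.to (T-∨ {toℕ u ≡ᵇ toℕ v}) t′
  ...   | inj₁ same      = u≢v (toℕ-injective (≡ᵇ⇒≡ _ _ same))
  ...   | inj₂ different = not-T different (≡⇒≡ᵇ _ _ pu≡pv)

  cliquePair-complete : ∀ u v → Separated p S u v → T (cliquePairᵇ (multipartiteAdj p) S (u , v))
  cliquePair-complete u v sep with lookup S u | lookup S v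
  ... | false | _     = _
  ... | true  | false = _
  ... | true  | true  with u ≟ᶠ v
  ...   | yes refl = Equivalence.from (T-∨ {toℕ u ≡ᵇ toℕ u}) (inj₁ (≡⇒≡ᵇ (toℕ u) _ refl))
  ...   | no u≢v   = Equivalence.from (T-∨ {toℕ u ≡ᵇ toℕ v}) (inj₂ (T-not (λ same →
      sep _ _ u≢v (≡ᵇ⇒≡ _ _ same))))

  clique-sound : T (isCliqueᵇ (multipartiteAdj p) S) → Rainbow p (λ _ → false) S
  clique-sound t = (λ u v → cliquePair-sound u v (All.lookup (all⁺ _ _ t)
                     (∈-cartesianProduct⁺ (∈-allFin u) (∈-allFin v))))
                 , (λ _ _ ())

  clique-complete : Rainbow p (λ _ → false) S → T (isCliqueᵇ (multipartiteAdj p) S)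
  clique-complete r = all⁻ (cliquePairᵇ (multipartiteAdj p) S) {cartesianProduct (allFin n) (allFin n)}
    (All.tabulate (λ {(u , v)} _ → cliquePair-complete u v (Rainbow.separated r u v)))

  isClique≡rainbowᵇ : isCliqueᵇ (multipartiteAdj p) S ≡ rainbowᵇ p (λ _ → false) S
  isClique≡rainbowᵇ = T-ext (rainbowᵇ-complete S ∘ clique-sound) (clique-complete ∘ rainbowᵇ-sound S)

rainbowCount : (n : ℕ) → (Fin n → ℕ) → (ℕ → Bool) → ℕ → ℕ
rainbowCount n p F k = count (λ S → (∣ S ∣ ≡ᵇ k) ∧ rainbowᵇ p F S) (allSubsets n)

binomT≡rainbowCount : ∀ n k r → binomT n k r ≡ rainbowCount n (part r) (λ _ → false) k
binomT≡rainbowCount n k r = trans (length-filter _ (allSubsets n))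
  (count-cong (λ S → cong ((∣ S ∣ ≡ᵇ k) ∧_) (isClique≡rainbowᵇ (part r) S)) (allSubsets n))

rainbowCount-split : ∀ n (p : Fin (suc n) → ℕ) F k → rainbowCount (suc n) p F k ≡
  count (λ S → (suc ∣ S ∣ ≡ᵇ k) ∧ (not (F (p zero)) ∧ rainbowᵇ (p ∘ suc) (forbid (p zero) F) S))
        (allSubsets n)
  + rainbowCount n (p ∘ suc) F k
rainbowCount-split n p F k =
  trans (count-++ _ (map (true ∷_) (allSubsets n)) (map (false ∷_) (allSubsets n)))
        (cong₂ _+_ (count-map _ (true ∷_) (allSubsets n)) (count-map _ (false ∷_) (allSubsets n)))

rainbowCount-zero : ∀ n (p : Fin n → ℕ) F → rainbowCount n p F 0 ≡ 1
rainbowCount-zero zero    p F = refl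
rainbowCount-zero (suc n) p F = trans (rainbowCount-split n p F 0)
  (cong₂ _+_ (count-false (λ _ → refl) (allSubsets n)) (rainbowCount-zero n (p ∘ suc) F))

rainbowCount-forbidden : ∀ n (p : Fin (suc n) → ℕ) F k → F (p zero) ≡ true →
  rainbowCount (suc n) p F (suc k) ≡ rainbowCount n (p ∘ suc) F (suc k)
rainbowCount-forbidden n p F k Fp₀ = trans (rainbowCount-split n p F (suc k))
  (cong (_+ rainbowCount n (p ∘ suc) F (suc k)) (count-false excluded (allSubsets n)))
  where
  excluded : ∀ S → (∣ S ∣ ≡ᵇ k) ∧ (not (F (p zero)) ∧ rainbowᵇ (p ∘ suc) (forbid (p zero) F) S) ≡ false
  excluded S rewrite Fp₀ = ∧-zeroʳ (∣ S ∣ ≡ᵇ k)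

rainbowCount-allowed : ∀ n (p : Fin (suc n) → ℕ) F k → F (p zero) ≡ false →
  rainbowCount (suc n) p F (suc k) ≡
  rainbowCount n (p ∘ suc) (forbid (p zero) F) k + rainbowCount n (p ∘ suc) F (suc k)
rainbowCount-allowed n p F k Fp₀ = trans (rainbowCount-split n p F (suc k))
  (cong (_+ rainbowCount n (p ∘ suc) F (suc k)) (count-cong chosen (allSubsets n)))
  where
  chosen : ∀ S → (∣ S ∣ ≡ᵇ k) ∧ (not (F (p zero)) ∧ rainbowᵇ (p ∘ suc) (forbid (p zero) F) S)
               ≡ (∣ S ∣ ≡ᵇ k) ∧ rainbowᵇ (p ∘ suc) (forbid (p zero) F) S
  chosen S rewrite Fp₀ = refl

-- e φ r k is the k-th elementary symmetric polynomial in the r numbers φ 0, …, φ (r-1).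
e : (ℕ → ℕ) → ℕ → ℕ → ℕ
e φ r       zero    = 1
e φ zero    (suc k) = 0
e φ (suc r) (suc k) = e φ r (suc k) + φ r * e φ r k

e-cong : ∀ r {φ ψ : ℕ → ℕ} → (∀ i → i < r → φ i ≡ ψ i) → ∀ k → e φ r k ≡ e ψ r k
e-cong r       φ≗ψ zero    = refl
e-cong zero    φ≗ψ (suc k) = refl
e-cong (suc r) {φ} {ψ} φ≗ψ (suc k) =
  cong₂ _+_ (e-cong r below (suc k)) (cong₂ _*_ (φ≗ψ r ≤-refl) (e-cong r below k))
  where
  below : ∀ i → i < r → φ i ≡ ψ i
  below i i<r = φ≗ψ i (m<n⇒m<1+n i<r)

e-zero-last : ∀ r {φ : ℕ → ℕ} → φ r ≡ 0 → ∀ k → e φ (suc r) k ≡ e φ r k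
e-zero-last r φr≡0 zero    = refl
e-zero-last r {φ} φr≡0 (suc k) =
  trans (cong (λ x → e φ r (suc k) + x * e φ r k) φr≡0) (+-identityʳ _)

zeroAt : ℕ → (ℕ → ℕ) → ℕ → ℕ
zeroAt c φ i = if c ≡ᵇ i then 0 else φ i

zeroAt-self : ∀ c (φ : ℕ → ℕ) → zeroAt c φ c ≡ 0
zeroAt-self c φ = cong (if_then 0 else φ c) (dec-true (c ≟ c) refl)

zeroAt-other : ∀ {c i} (φ : ℕ → ℕ) → c ≢ i → zeroAt c φ i ≡ φ i
zeroAt-other {c} {i} φ c≢i = cong (if_then 0 else φ i) (dec-false (c ≟ i) c≢i)

e-extract : ∀ r c (φ : ℕ → ℕ) k → c < r →
  e φ r (suc k) ≡ e (zeroAt c φ) r (suc k) + φ c * e (zeroAt c φ) r k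
e-extract (suc r) c φ k c<1+r with m<1+n⇒m<n∨m≡n c<1+r
... | inj₂ refl = cong₂ _+_ (sym (dropZero (suc k))) (cong (φ c *_) (sym (dropZero k)))
  where
  dropZero : ∀ j → e (zeroAt c φ) (suc c) j ≡ e φ c j
  dropZero j = trans (e-zero-last c (zeroAt-self c φ) j)
                     (e-cong c (λ i i<c → zeroAt-other φ (>⇒≢ i<c)) j)
... | inj₁ c<r = step k
  where
  χ : ℕ → ℕ
  χ = zeroAt c φ
  χr : χ r ≡ φ r
  χr = zeroAt-other φ (<⇒≢ c<r)
  step : ∀ k → e φ (suc r) (suc k) ≡ e χ (suc r) (suc k) + φ c * e χ (suc r) k
  step zero rewrite χr | e-extract r c φ zero c<r =
    solve 3 (λ A x y → (A :+ x :* con 1) :+ y :* con 1 := (A :+ y :* con 1) :+ x :* con 1)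
      refl (e χ r 1) (φ c) (φ r)
  step (suc k) rewrite χr | e-extract r c φ (suc k) c<r | e-extract r c φ k c<r =
    solve 5 (λ A B D x y → (A :+ x :* B) :+ y :* (B :+ x :* D) := (A :+ y :* B) :+ x :* (B :+ y :* D))
      refl (e χ r (suc (suc k))) (e χ r (suc k)) (e χ r k) (φ c) (φ r)

e-bump : ∀ r c (φ ψ : ℕ → ℕ) k → c < r → (∀ i → ψ i ≡ φ i + 𝟙 (c ≡ᵇ i)) →
  e ψ r (suc k) ≡ e φ r (suc k) + e (zeroAt c φ) r k
e-bump r c φ ψ k c<r ψ≡φ+δ = begin
  e ψ r (suc k)                                   ≡⟨ e-extract r c ψ k c<r ⟩
  e (zeroAt c ψ) r (suc k) + ψ c * e (zeroAt c ψ) r k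
    ≡⟨ cong₂ _+_ (e-cong r (λ i _ → sameZeroAt i) (suc k))
                 (cong₂ _*_ ψc (e-cong r (λ i _ → sameZeroAt i) k)) ⟩
  E₁ + (φ c + 1) * E₀
    ≡⟨ solve 3 (λ E₁ x E₀ → E₁ :+ (x :+ con 1) :* E₀ := (E₁ :+ x :* E₀) :+ E₀) refl E₁ (φ c) E₀ ⟩
  (E₁ + φ c * E₀) + E₀                            ≡⟨ cong (_+ E₀) (e-extract r c φ k c<r) ⟨
  e φ r (suc k) + E₀                              ∎
  where
  open ≡-Reasoning
  E₁ E₀ : ℕ
  E₁ = e (zeroAt c φ) r (suc k)
  E₀ = e (zeroAt c φ) r k
  sameZeroAt : ∀ i → zeroAt c ψ i ≡ zeroAt c φ i
  sameZeroAt i with c ≡ᵇ i | ψ≡φ+δ i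
  ... | true  | _   = refl
  ... | false | ψi = trans ψi (+-identityʳ _)
  ψc : ψ c ≡ φ c + 1
  ψc = trans (ψ≡φ+δ c) (cong (λ b → φ c + 𝟙 b) (dec-true (c ≟ c) refl))

remove : ℕ → (ℕ → ℕ) → ℕ → ℕ
remove c φ i = if i <ᵇ c then φ i else φ (suc i)

remove-below : ∀ {c i} (φ : ℕ → ℕ) → i < c → remove c φ i ≡ φ i
remove-below {c} {i} φ i<c = cong (if_then φ i else φ (suc i)) (dec-true (i <? c) i<c)

remove-above : ∀ {c i} (φ : ℕ → ℕ) → c ≤ i → remove c φ i ≡ φ (suc i)
remove-above {c} {i} φ c≤i = cong (if_then φ i else φ (suc i)) (dec-false (i <? c) (≤⇒≯ c≤i))

e-remove : ∀ s c (φ : ℕ → ℕ) k → c < suc s → φ c ≡ 0 → e φ (suc s) k ≡ e (remove c φ) s k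
e-remove s c φ zero    _ _ = refl
e-remove s c φ (suc k) c<1+s φc≡0 with m<1+n⇒m<n∨m≡n c<1+s
... | inj₂ refl = trans (e-zero-last c φc≡0 (suc k))
                        (e-cong c (λ i i<c → sym (remove-below φ i<c)) (suc k))
e-remove (suc s) c φ (suc k) _ φc≡0 | inj₁ c<1+s =
  cong₂ _+_ (e-remove s c φ (suc k) c<1+s φc≡0)
            (cong₂ _*_ (sym (remove-above φ (≤-pred c<1+s))) (e-remove s c φ k c<1+s φc≡0))

e-zeros : ∀ r {φ : ℕ → ℕ} → (∀ i → i < r → φ i ≡ 0) → ∀ k → e φ r (suc k) ≡ 0
e-zeros zero    φ≡0 k = refl
e-zeros (suc r) φ≡0 k =
  trans (e-zero-last r (φ≡0 r ≤-refl) (suc k)) (e-zeros r (λ i i<r → φ≡0 i (m<n⇒m<1+n i<r)) k)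

classSize : (n : ℕ) → (Fin n → ℕ) → ℕ → ℕ
classSize zero    p i = 0
classSize (suc n) p i = 𝟙 (p zero ≡ᵇ i) + classSize n (p ∘ suc) i

allowedSize : (n : ℕ) → (Fin n → ℕ) → (ℕ → Bool) → ℕ → ℕ
allowedSize n p F i = if F i then 0 else classSize n p i

F-separates : ∀ (F : ℕ → Bool) {c i} → F c ≡ true → F i ≡ false → c ≢ i
F-separates F Fc Fi c≡i with () ← trans (sym Fc) (trans (cong F c≡i) Fi)

allowedSize-forbidden : ∀ n (p : Fin (suc n) → ℕ) F → F (p zero) ≡ true →
  ∀ i → allowedSize (suc n) p F i ≡ allowedSize n (p ∘ suc) F i
allowedSize-forbidden n p F Fp₀ i with F i in Fi
... | true  = refl
... | false = cong (λ b → 𝟙 b + classSize n (p ∘ suc) i) (dec-false (p zero ≟ i) (F-separates F Fp₀ Fi))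

allowedSize-allowed : ∀ n (p : Fin (suc n) → ℕ) F → F (p zero) ≡ false →
  ∀ i → allowedSize (suc n) p F i ≡ allowedSize n (p ∘ suc) F i + 𝟙 (p zero ≡ᵇ i)
allowedSize-allowed n p F Fp₀ i with F i in Fi
... | false = +-comm (𝟙 (p zero ≡ᵇ i)) _
... | true  = cong 𝟙 (sym (dec-false (p zero ≟ i) (≢-sym (F-separates F Fi Fp₀))))

zeroAt-allowedSize : ∀ n (p : Fin n → ℕ) F c i →
  zeroAt c (allowedSize n p F) i ≡ allowedSize n p (forbid c F) i
zeroAt-allowedSize n p F c i with c ≡ᵇ i
... | true  = refl
... | false = refl

-- A k-element rainbow set chooses k allowed classes and one vertex in each of them,
-- so for labels below r their number is e_k of the allowed class sizes.
rainbowCount-e : ∀ n r (p : Fin n → ℕ) F → (∀ v → p v < r) → ∀ k →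
  rainbowCount n p F k ≡ e (allowedSize n p F) r k
rainbowCount-e zero    r p F _ zero    = refl
rainbowCount-e zero    r p F _ (suc k) = sym (e-zeros r (λ i _ → empty i) k)
  where
  empty : ∀ i → allowedSize zero p F i ≡ 0
  empty i with F i
  ... | true  = refl
  ... | false = refl
rainbowCount-e (suc n) r p F p<r zero = rainbowCount-zero (suc n) p F
rainbowCount-e (suc n) r p F p<r (suc k) with F (p zero) in Fp₀
... | true = begin
  rainbowCount (suc n) p F (suc k)         ≡⟨ rainbowCount-forbidden n p F k Fp₀ ⟩
  rainbowCount n (p ∘ suc) F (suc k)       ≡⟨ rainbowCount-e n r (p ∘ suc) F (p<r ∘ suc) (suc k) ⟩
  e (allowedSize n (p ∘ suc) F) r (suc k)  ≡⟨ e-cong r (λ i _ → allowedSize-forbidden n p F Fp₀ i) (suc k) ⟨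
  e (allowedSize (suc n) p F) r (suc k)    ∎
  where open ≡-Reasoning
... | false = begin
  rainbowCount (suc n) p F (suc k)
    ≡⟨ rainbowCount-allowed n p F k Fp₀ ⟩
  rainbowCount n (p ∘ suc) (forbid c F) k + rainbowCount n (p ∘ suc) F (suc k)
    ≡⟨ cong₂ _+_ (rainbowCount-e n r (p ∘ suc) (forbid c F) (p<r ∘ suc) k)
                 (rainbowCount-e n r (p ∘ suc) F (p<r ∘ suc) (suc k)) ⟩
  e (allowedSize n (p ∘ suc) (forbid c F)) r k + e φ r (suc k)
    ≡⟨ +-comm _ (e φ r (suc k)) ⟩
  e φ r (suc k) + e (allowedSize n (p ∘ suc) (forbid c F)) r k
    ≡⟨ cong (e φ r (suc k) +_) (e-cong r (λ i _ → zeroAt-allowedSize n (p ∘ suc) F c i) k) ⟨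
  e φ r (suc k) + e (zeroAt c φ) r k
    ≡⟨ e-bump r c φ (allowedSize (suc n) p F) k (p<r zero) (allowedSize-allowed n p F Fp₀) ⟨
  e (allowedSize (suc n) p F) r (suc k) ∎
  where
  open ≡-Reasoning
  c : ℕ
  c = p zero
  φ : ℕ → ℕ
  φ = allowedSize n (p ∘ suc) F

divMod-unique : ∀ c q d → c < suc d →
  (c + q * suc d) % suc d ≡ c × (c + q * suc d) / suc d ≡ q
divMod-unique c q d c<d =
  trans ([m+kn]%n≡m%n c q (suc d)) (m<n⇒m%n≡m c<d) ,
  trans (+-distrib-/ c (q * suc d) c%d+0<d) (cong₂ _+_ (m<n⇒m/n≡0 c<d) (m*n/n≡m q (suc d)))
  where
  c%d+0<d : c % suc d + q * suc d % suc d < suc d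
  c%d+0<d = subst (_< suc d)
    (sym (trans (cong₂ _+_ (m<n⇒m%n≡m c<d) (m*n%n≡0 q (suc d))) (+-identityʳ c))) c<d

turánSize : ℕ → ℕ → ℕ → ℕ
turánSize s n i = n / suc s + 𝟙 (i <ᵇ n % suc s)

turánSize-decomp : ∀ s c q i → c ≤ suc s → i < suc s →
  turánSize s (c + q * suc s) i ≡ q + 𝟙 (i <ᵇ c)
turánSize-decomp s c q i c≤1+s i<1+s with m≤n⇒m<n∨m≡n c≤1+s
... | inj₁ c<1+s =
  let c%≡c , c/≡q = divMod-unique c q s c<1+s in
  cong₂ (λ x y → x + 𝟙 (i <ᵇ y)) c/≡q c%≡c
... | inj₂ refl =
  let 0%≡0 , 0/≡1+q = divMod-unique 0 (suc q) s z<s in begin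
  turánSize s (0 + suc q * suc s) i       ≡⟨ cong₂ (λ x y → x + 𝟙 (i <ᵇ y)) 0/≡1+q 0%≡0 ⟩
  suc q + 0                               ≡⟨ +-identityʳ (suc q) ⟩
  suc q                                   ≡⟨ +-comm q 1 ⟨
  q + 1                                   ≡⟨ cong (λ b → q + 𝟙 b) (dec-true (i <? suc s) i<1+s) ⟨
  q + 𝟙 (i <ᵇ suc s)                      ∎
  where open ≡-Reasoning

𝟙-<-suc : ∀ i c → 𝟙 (i <ᵇ suc c) ≡ 𝟙 (i <ᵇ c) + 𝟙 (c ≡ᵇ i)
𝟙-<-suc zero    zero    = refl
𝟙-<-suc zero    (suc c) = refl
𝟙-<-suc (suc i) zero    = refl
𝟙-<-suc (suc i) (suc c) = 𝟙-<-suc i c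

turánSize-suc : ∀ s n i → i < suc s →
  turánSize s (suc n) i ≡ turánSize s n i + 𝟙 (n % suc s ≡ᵇ i)
turánSize-suc s n i i<1+s = begin
  turánSize s (suc n) i                   ≡⟨ cong (λ m → turánSize s (suc m) i) (m≡m%n+[m/n]*n n (suc s)) ⟩
  turánSize s (suc c + q * suc s) i       ≡⟨ turánSize-decomp s (suc c) q i (m%n<n n (suc s)) i<1+s ⟩
  q + 𝟙 (i <ᵇ suc c)                      ≡⟨ cong (q +_) (𝟙-<-suc i c) ⟩
  q + (𝟙 (i <ᵇ c) + 𝟙 (c ≡ᵇ i))           ≡⟨ +-assoc q _ _ ⟨
  turánSize s n i + 𝟙 (c ≡ᵇ i)            ∎
  where
  open ≡-Reasoning
  c q : ℕ
  c = n % suc s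
  q = n / suc s

classSize-cong : ∀ n {p p′ : Fin n → ℕ} → (∀ v → p v ≡ p′ v) → ∀ i → classSize n p i ≡ classSize n p′ i
classSize-cong zero    p≗p′ i = refl
classSize-cong (suc n) p≗p′ i =
  cong₂ _+_ (cong (λ x → 𝟙 (x ≡ᵇ i)) (p≗p′ zero)) (classSize-cong n (p≗p′ ∘ suc) i)

classSize-snoc : ∀ n (p : Fin (suc n) → ℕ) i →
  classSize (suc n) p i ≡ classSize n (p ∘ inject₁) i + 𝟙 (p (fromℕ n) ≡ᵇ i)
classSize-snoc zero    p i = +-comm (𝟙 (p zero ≡ᵇ i)) 0
classSize-snoc (suc n) p i = trans (cong (𝟙 (p zero ≡ᵇ i) +_) (classSize-snoc n (p ∘ suc) i))
                                   (sym (+-assoc (𝟙 (p zero ≡ᵇ i)) _ _))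

turánClass-snoc : ∀ n s i →
  classSize (suc n) (part (suc s)) i ≡ classSize n (part (suc s)) i + 𝟙 (n % suc s ≡ᵇ i)
turánClass-snoc n s i = trans (classSize-snoc n (part (suc s)) i)
  (cong₂ _+_ (classSize-cong n (λ v → cong (_% suc s) (toℕ-inject₁ v)) i)
             (cong (λ x → 𝟙 (x % suc s ≡ᵇ i)) (toℕ-fromℕ n)))

classSize-turán : ∀ n s i → i < suc s → classSize n (part (suc s)) i ≡ turánSize s n i
classSize-turán zero    s i i<1+s = refl
classSize-turán (suc n) s i i<1+s = begin
  classSize (suc n) (part (suc s)) i                          ≡⟨ turánClass-snoc n s i ⟩
  classSize n (part (suc s)) i + 𝟙 (n % suc s ≡ᵇ i)           ≡⟨ cong (_+ 𝟙 (n % suc s ≡ᵇ i)) (classSize-turán n s i i<1+s) ⟩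
  turánSize s n i + 𝟙 (n % suc s ≡ᵇ i)                        ≡⟨ turánSize-suc s n i i<1+s ⟨
  turánSize s (suc n) i                                       ∎
  where open ≡-Reasoning

binomT-e : ∀ n k s → binomT n k (suc s) ≡ e (classSize n (part (suc s))) (suc s) k
binomT-e n k s = trans (binomT≡rainbowCount n k (suc s))
  (rainbowCount-e n (suc s) (part (suc s)) (λ _ → false) (λ v → m%n<n (toℕ v) (suc s)) k)

-- Removing a smallest class (of n / (s+1) vertices) from T_{n,s+1} leaves
-- n mod (s+1) + (n / (s+1)) s vertices.
remainingVertices : ∀ n s → n ∸ n / suc s ≡ n % suc s + n / suc s * s
remainingVertices n s = begin
  n ∸ q                        ≡⟨ cong (_∸ q) (m≡m%n+[m/n]*n n (suc s)) ⟩
  (c + q * suc s) ∸ q          ≡⟨ cong (_∸ q) (solve 3 (λ c q s → c :+ q :* (con 1 :+ s) := q :+ (c :+ q :* s)) refl c q s) ⟩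
  (q + (c + q * s)) ∸ q        ≡⟨ m+n∸m≡n q _ ⟩
  c + q * s                    ∎
  where
  open ≡-Reasoning
  c q : ℕ
  c = n % suc s
  q = n / suc s

remainingSizes : ∀ n t i → i < suc t →
  let c = n % suc (suc t) in
  remove c (zeroAt c (classSize n (part (suc (suc t))))) i ≡
  classSize (n ∸ n / suc (suc t)) (part (suc t)) i
remainingSizes n t i i<1+t = trans deleted (sym remaining)
  where
  open ≡-Reasoning
  c q : ℕ
  c = n % suc (suc t)
  q = n / suc (suc t)
  size : ℕ → ℕ
  size = classSize n (part (suc (suc t)))
  remaining : classSize (n ∸ q) (part (suc t)) i ≡ q + 𝟙 (i <ᵇ c)
  remaining = begin
    classSize (n ∸ q) (part (suc t)) i   ≡⟨ classSize-turán (n ∸ q) t i i<1+t ⟩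
    turánSize t (n ∸ q) i                ≡⟨ cong (λ m → turánSize t m i) (remainingVertices n (suc t)) ⟩
    turánSize t (c + q * suc t) i        ≡⟨ turánSize-decomp t c q i (≤-pred (m%n<n n (suc (suc t)))) i<1+t ⟩
    q + 𝟙 (i <ᵇ c)                       ∎
  deleted : remove c (zeroAt c size) i ≡ q + 𝟙 (i <ᵇ c)
  deleted with i <? c
  ... | yes i<c = begin
    remove c (zeroAt c size) i   ≡⟨ remove-below (zeroAt c size) i<c ⟩
    zeroAt c size i              ≡⟨ zeroAt-other size (>⇒≢ i<c) ⟩
    size i                       ≡⟨ classSize-turán n (suc t) i (m<n⇒m<1+n i<1+t) ⟩
    q + 𝟙 (i <ᵇ c)               ∎
  ... | no i≮c = begin
    remove c (zeroAt c size) i   ≡⟨ remove-above (zeroAt c size) (≮⇒≥ i≮c) ⟩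
    zeroAt c size (suc i)        ≡⟨ zeroAt-other size (<⇒≢ (s≤s (≮⇒≥ i≮c))) ⟩
    size (suc i)                 ≡⟨ classSize-turán n (suc t) (suc i) (s≤s i<1+t) ⟩
    q + 𝟙 (suc i <ᵇ c)           ≡⟨ cong (λ b → q + 𝟙 b) (dec-false (suc i <? c) (i≮c ∘ <-trans (n<1+n i))) ⟩
    q + 0                        ≡⟨ cong (λ b → q + 𝟙 b) (dec-false (i <? c) i≮c) ⟨
    q + 𝟙 (i <ᵇ c)               ∎

-- The cliques through a vertex of the class c are the cliques of the graph left after
-- deleting that class.
binomT-remaining : ∀ n j s →
  let c = n % suc s in
  binomT (n ∸ n / suc s) j s ≡ e (remove c (zeroAt c (classSize n (part (suc s))))) s j
binomT-remaining n j zero rewrite n/1≡n n | n∸n≡0 n = emptyGraph j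
  where
  emptyGraph : ∀ {φ} j → binomT 0 j 0 ≡ e φ 0 j
  emptyGraph zero    = refl
  emptyGraph (suc j) = refl
binomT-remaining n j (suc t) = trans (binomT-e (n ∸ n / suc (suc t)) j t)
  (e-cong (suc t) (λ i i<1+t → sym (remainingSizes n t i i<1+t)) j)

-- Pascal's rule for Turán cliques: a (j+1)-clique of T_{n+1,s+1} either avoids the new
-- vertex, or consists of it and a j-clique of the other s classes, which form T_{n - n/(s+1), s}.
turán-pascal : ∀ n j s →
  binomT (suc n) (suc j) (suc s) ≡ binomT n (suc j) (suc s) + binomT (n ∸ n div suc s) j s
turán-pascal n j s = begin
  binomT (suc n) (suc j) (suc s)
    ≡⟨ binomT-e (suc n) (suc j) s ⟩
  e (classSize (suc n) (part (suc s))) (suc s) (suc j)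
    ≡⟨ e-bump (suc s) c size (classSize (suc n) (part (suc s))) j (m%n<n n (suc s)) (turánClass-snoc n s) ⟩
  e size (suc s) (suc j) + e (zeroAt c size) (suc s) j
    ≡⟨ cong₂ _+_ (sym (binomT-e n (suc j) s))
                 (e-remove s c (zeroAt c size) j (m%n<n n (suc s)) (zeroAt-self c size)) ⟩
  binomT n (suc j) (suc s) + e (remove c (zeroAt c size)) s j
    ≡⟨ cong (binomT n (suc j) (suc s) +_) (binomT-remaining n j s) ⟨
  binomT n (suc j) (suc s) + binomT (n ∸ n div suc s) j s ∎
  where
  open ≡-Reasoning
  c : ℕ
  c = n % suc s
  size : ℕ → ℕ
  size = classSize n (part (suc s))

binomT-zero : ∀ n s → binomT n 0 s ≡ 1
binomT-zero n s = trans (binomT≡rainbowCount n 0 s) (rainbowCount-zero n (part s) _)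

remaining-≥ : ∀ n j s → j ≤ s → j ≤ n → j ≤ n ∸ n / suc s
remaining-≥ n j s j≤s j≤n with n / suc s in q≡
... | zero   = j≤n
... | suc q′ = begin
  j                          ≤⟨ j≤s ⟩
  s                          ≤⟨ m≤m+n s (q′ * s) ⟩
  suc q′ * s                 ≤⟨ m≤n+m _ (n % suc s) ⟩
  n % suc s + suc q′ * s     ≡⟨ cong (λ x → n % suc s + x * s) q≡ ⟨
  n % suc s + n / suc s * s  ≡⟨ remainingVertices n s ⟨
  n ∸ n / suc s              ≡⟨ cong (n ∸_) q≡ ⟩
  n ∸ suc q′                 ∎
  where open ≤-Reasoning

binomT-positive : ∀ j n s → j ≤ s → j ≤ n → 1 ≤ binomT n j s
binomT-positive zero    n       s       _         _         = ≤-reflexive (sym (binomT-zero n s))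
binomT-positive (suc j) (suc n) (suc s) (s≤s j≤s) (s≤s j≤n) = begin
  1                                                     ≤⟨ binomT-positive j (n ∸ n / suc s) s j≤s (remaining-≥ n j s j≤s j≤n) ⟩
  binomT (n ∸ n / suc s) j s                            ≤⟨ m≤n+m _ _ ⟩
  binomT n (suc j) (suc s) + binomT (n ∸ n / suc s) j s ≡⟨ turán-pascal n j s ⟨
  binomT (suc n) (suc j) (suc s)                        ∎
  where open ≤-Reasoning

-- A nondecreasing function f given by its increments d: f (a+1) = f a + d a.  Every q in
-- its range splits uniquely as q = f a + x with 0 ≤ x < d a (greedy digit extraction).
module Increments (f d : ℕ → ℕ) (f-step : ∀ a → f (suc a) ≡ f a + d a) where

  f-step-≤ : ∀ a → f a ≤ f (suc a)
  f-step-≤ a = ≤-trans (m≤m+n (f a) (d a)) (≤-reflexive (sym (f-step a)))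

  f-mono : ∀ {a b} → a ≤ b → f a ≤ f b
  f-mono {b = zero}  z≤n = ≤-refl
  f-mono {a} {suc b} a≤1+b with m≤n⇒m<n∨m≡n a≤1+b
  ... | inj₂ refl  = ≤-refl
  ... | inj₁ a<1+b = ≤-trans (f-mono (≤-pred a<1+b)) (f-step-≤ b)

  below-next : ∀ {q a x} → q ≡ f a + x → x < d a → q < f (suc a)
  below-next {q} {a} {x} q≡ x<d = begin-strict
    q          ≡⟨ q≡ ⟩
    f a + x    <⟨ +-monoʳ-< (f a) x<d ⟩
    f a + d a  ≡⟨ f-step a ⟨
    f (suc a)  ∎
    where open ≤-Reasoning

  decompose : f 0 ≡ 0 → ∀ q N → q < f N →
    Σ ℕ λ a → Σ ℕ λ x → a < N × q ≡ f a + x × x < d a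
  decompose f0≡0 q zero q<f0 with () ← subst (q <_) f0≡0 q<f0
  decompose f0≡0 q (suc N) q<f[1+N] with q <? f N
  ... | yes q<fN =
    let a , x , a<N , q≡ , x<d = decompose f0≡0 q N q<fN in a , x , m<n⇒m<1+n a<N , q≡ , x<d
  ... | no q≮fN = N , q ∸ f N , n<1+n N , q≡ , +-cancelˡ-< (f N) _ _ q<fN+dN
    where
    q≡ : q ≡ f N + (q ∸ f N)
    q≡ = sym (m+[n∸m]≡n (≮⇒≥ q≮fN))
    q<fN+dN : f N + (q ∸ f N) < f N + d N
    q<fN+dN = subst₂ _<_ q≡ (f-step N) q<f[1+N]

  -- Uniqueness: the intervals [f a, f a + d a) are disjoint.
  decompose-unique : ∀ {q a x a′ x′} → q ≡ f a + x → x < d a → q ≡ f a′ + x′ → x′ < d a′ →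
    a′ ≡ a × x′ ≡ x
  decompose-unique {q} {a} {x} {a′} {x′} q≡ x<d q≡′ x′<d′ = a′≡a , x′≡x
    where
    separate : ∀ {a a′ x x′} → a < a′ → q ≡ f a + x → x < d a → q ≡ f a′ + x′ → ⊥
    separate {a} {a′} {x} {x′} a<a′ q≡ x<d q≡′ = <-irrefl refl (begin-strict
      q          <⟨ below-next q≡ x<d ⟩
      f (suc a)  ≤⟨ f-mono a<a′ ⟩
      f a′       ≤⟨ m≤m+n (f a′) x′ ⟩
      f a′ + x′  ≡⟨ q≡′ ⟨
      q          ∎)
      where open ≤-Reasoning
    a′≡a : a′ ≡ a
    a′≡a with <-cmp a a′
    ... | tri< a<a′ _ _ = ⊥-elim (separate a<a′ q≡ x<d q≡′)
    ... | tri≈ _ a≡a′ _ = sym a≡a′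
    ... | tri> _ _ a′<a = ⊥-elim (separate a′<a q≡′ x′<d′ q≡)
    x′≡x : x′ ≡ x
    x′≡x = +-cancelˡ-≡ (f a) x′ x (trans (cong (λ b → f b + x′) (sym a′≡a)) (trans (sym q≡′) q≡))

  unbounded : ∀ a₀ → (∀ a → a₀ ≤ a → 0 < d a) → ∀ t → t ≤ f (t + a₀)
  unbounded a₀ d>0 zero    = z≤n
  unbounded a₀ d>0 (suc t) = begin
    1 + t                       ≤⟨ +-mono-≤ (d>0 (t + a₀) (m≤n+m a₀ t)) (unbounded a₀ d>0 t) ⟩
    d (t + a₀) + f (t + a₀)     ≡⟨ +-comm (d (t + a₀)) _ ⟩
    f (t + a₀) + d (t + a₀)     ≡⟨ f-step (t + a₀) ⟨
    f (suc t + a₀)              ∎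
    where open ≤-Reasoning

∃!₃ : (ℕ → ℕ → ℕ → Set) → Set
∃!₃ P = Σ ℕ λ a → Σ ℕ λ b → Σ ℕ λ m →
  P a b m × ((a′ b′ m′ : ℕ) → P a′ b′ m′ → (a′ ≡ a) × (b′ ≡ b) × (m′ ≡ m))

module TwoLevel (f g h A B : ℕ → ℕ)
  (f-step : ∀ a → f (suc a) ≡ f a + g (A a)) (g-step : ∀ b → g (suc b) ≡ g b + h (B b))
  (f0≡0 : f 0 ≡ 0) (g0≡0 : g 0 ≡ 0) where

  module F = Increments f (g ∘ A) f-step
  module G = Increments g (h ∘ B) g-step

  Repr₂ : ℕ → ℕ → ℕ → ℕ → Set
  Repr₂ q a b m = (q ≡ f a + g b + m) × (b < A a) × (m < h (B b))

  representation : (∀ q → Σ ℕ λ N → q < f N) → ∀ q → ∃!₃ (Repr₂ q)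
  representation f-unbounded q with f-unbounded q
  ... | N , q<fN with F.decompose f0≡0 q N q<fN
  ... | a , x , _ , q≡fa+x , x<gA with G.decompose g0≡0 x (A a) x<gA
  ... | b , m , b<A , x≡gb+m , m<h = a , b , m , (q≡fa+gb+m , b<A , m<h) , unique
    where
    q≡fa+gb+m : q ≡ f a + g b + m
    q≡fa+gb+m = trans q≡fa+x (trans (cong (f a +_) x≡gb+m) (sym (+-assoc (f a) (g b) m)))
    unique : ∀ a′ b′ m′ → Repr₂ q a′ b′ m′ → (a′ ≡ a) × (b′ ≡ b) × (m′ ≡ m)
    unique a′ b′ m′ (q≡′ , b′<A′ , m′<h′) with
      F.decompose-unique q≡fa+x x<gA (trans q≡′ (+-assoc (f a′) (g b′) m′))
                         (≤-trans (G.below-next refl m′<h′) (G.f-mono b′<A′))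
    ... | a′≡a , x′≡x = a′≡a , G.decompose-unique x≡gb+m m<h (sym x′≡x) m′<h′

binomT-unbounded : ∀ j s → j ≤ s → ∀ q → Σ ℕ λ N → q < binomT N (suc j) (suc s)
binomT-unbounded j s j≤s q = suc q + j ,
  Increments.unbounded (λ a → binomT a (suc j) (suc s)) (λ a → binomT (a ∸ a div suc s) j s)
    (λ a → turán-pascal a j s) j
    (λ a j≤a → binomT-positive j (a ∸ a / suc s) s j≤s (remaining-≥ a j s j≤s j≤a)) (suc q)

-- Lemma 3.8: for r ≥ k ≥ 2, every q has a unique representation
-- q = binom(a,k)_r + binom(b,k-1)_{r-1} + m  with  b < a - ⌊a/r⌋  and
-- m < binom(b - ⌊b/(r-1)⌋, k-2)_{r-2}.
lemma3p8 : (r k q : ℕ) → 2 ≤ k → k ≤ r → 0 < q →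
    Σ ℕ (λ a → Σ ℕ (λ b → Σ ℕ (λ m →
    Repr r k q a b m ×
    ((a′ b′ m′ : ℕ) → Repr r k q a′ b′ m′ → (a′ ≡ a) × (b′ ≡ b) × (m′ ≡ m)))))
lemma3p8 (suc (suc r₂)) (suc (suc k₂)) q (s≤s (s≤s z≤n)) (s≤s (s≤s k₂≤r₂)) _ =
  TwoLevel.representation
    (λ a → binomT a (suc (suc k₂)) (suc (suc r₂))) (λ b → binomT b (suc k₂) (suc r₂))
    (λ c → binomT c k₂ r₂) (λ a → a ∸ a div suc (suc r₂)) (λ b → b ∸ b div suc r₂)
    (λ a → turán-pascal a (suc k₂) (suc r₂)) (λ b → turán-pascal b k₂ r₂) refl refl
    (binomT-unbounded (suc k₂) (suc r₂) (s≤s k₂≤r₂)) q
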